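{- Let $P$ be a functional Pure Type System. If $\lambda\Pi_P$ terminates (every well-typed term of $\lambda\Pi_P$ is strongly normalizing), then $P$ terminates (every well-typed term of $P$ is strongly normalizing for $\beta$-reduction).
   Context: A Pure Type System $P=\langle S,A,R\rangle$ consists of sorts $S$, axioms $A\subseteq S\times S$, rules $R\subseteq S\times S\times S$, with the usual PTS typing rules. $P$ is functional if $\langle s_1,s_2\rangle,\langle s_1,s_3\rangle\in A$ implies $s_2=s_3$ and $\langle s_1,s_2,s_3\rangle,\langle s_1,s_2,s_4\rangle\in R$ implies $s_3=s_4$. $\lambda\Pi_P$ is the $\lambda\Pi$-calculus (terms $x\mid Type\mid Kind\mid \Pi x:t~t\mid\lambda x:t~t\mid t~t$; axiom $Type:Kind$; products $\langle Type,Type,Type\rangle$, $\langle Type,Kind,Kind\rangle$) in the context $\Sigma_P$ and modulo rewrite rules, where $\Sigma_P$ declares, for each sort $s$, $U_s:Type$, $\varepsilon_s:U_s\Rightarrow Type$; for each axiom $\langle s_1,s_2\rangle$, $\dot{s_1}:U_{s_2}$; for each rule $\langle s_1,s_2,s_3\rangle$, $\dot\Pi_{\langle s_1,s_2,s_3\rangle}:\Pi X:U_{s_1}~(((\varepsilon_{s_1}~X)\Rightarrow U_{s_2})\Rightarrow U_{s_3})$; the rewrite rules are $\varepsilon_{s_2}~\dot{s_1}\longrightarrow U_{s_1}$ (axioms) and $\varepsilon_{s_3}(\dot\Pi_{\langle s_1,s_2,s_3\rangle}~X~Y)\longrightarrow \Pi x:(\varepsilon_{s_1}~X)~(\varepsilon_{s_2}~(Y~x))$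 (rules). Reduction in $\lambda\Pi_P$ is $\beta$-reduction together with these rewrite rules, and conversion in typing uses the congruence they generate. -}

module Defs where

open import Data.Nat using (ℕ; zero; suc)
open import Data.List using (List; []; _∷_)
open import Data.Empty using (⊥)
open import Data.Unit using (⊤)
open import Data.Product using (Σ; _×_; _,_)
open import Relation.Binary.PropositionalEquality using (_≡_)
open import Relation.Binary.Construct.Closure.Equivalence using (EqClosure)
open import Induction.WellFounded using (Acc)

-- Generic syntax (de Bruijn indices) over a set of sorts S and a set of
-- constants C (signature symbols).  Plain PTS terms use C = ⊥.

data Term (S C : Set) : Set where
  var : ℕ → Term S C
  srt : S → Term S C
  cst : C → Term S C
  pi  : Term S C → Term S C → Term S C   -- Π x:A. B   (B under one binder)
  lam : Term S C → Term S C → Term S C   -- λ x:A. b   (b under one binder)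
  app : Term S C → Term S C → Term S C

module _ {S C : Set} where

  ext : (ℕ → ℕ) → ℕ → ℕ
  ext ρ zero    = zero
  ext ρ (suc n) = suc (ρ n)

  rename : (ℕ → ℕ) → Term S C → Term S C
  rename ρ (var n)   = var (ρ n)
  rename ρ (srt s)   = srt s
  rename ρ (cst c)   = cst c
  rename ρ (pi A B)  = pi (rename ρ A) (rename (ext ρ) B)
  rename ρ (lam A b) = lam (rename ρ A) (rename (ext ρ) b)
  rename ρ (app t u) = app (rename ρ t) (rename ρ u)

  shift : Term S C → Term S C
  shift = rename suc

  exts : (ℕ → Term S C) → ℕ → Term S C
  exts σ zero    = var zero
  exts σ (suc n) = shift (σ n)

  subst : (ℕ → Term S C) → Term S C → Term S C
  subst σ (var n)   = σ n
  subst σ (srt s)   = srt s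
  subst σ (cst c)   = cst c
  subst σ (pi A B)  = pi (subst σ A) (subst (exts σ) B)
  subst σ (lam A b) = lam (subst σ A) (subst (exts σ) b)
  subst σ (app t u) = app (subst σ t) (subst σ u)

  _[_] : Term S C → Term S C → Term S C
  t [ u ] = subst σ t
    where
    σ : ℕ → Term S C
    σ zero    = u
    σ (suc n) = var n

  data Step (Rw : Term S C → Term S C → Set) : Term S C → Term S C → Set where
    beta  : ∀ {A b u} → Step Rw (app (lam A b) u) (b [ u ])
    rw    : ∀ {t u} → Rw t u → Step Rw t u
    piL   : ∀ {A A′ B} → Step Rw A A′ → Step Rw (pi A B) (pi A′ B)
    piR   : ∀ {A B B′} → Step Rw B B′ → Step Rw (pi A B) (pi A B′)
    lamL  : ∀ {A A′ b} → Step Rw A A′ → Step Rw (lam A b) (lam A′ b)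
    lamR  : ∀ {A b b′} → Step Rw b b′ → Step Rw (lam A b) (lam A b′)
    appL  : ∀ {t t′ u} → Step Rw t t′ → Step Rw (app t u) (app t′ u)
    appR  : ∀ {t u u′} → Step Rw u u′ → Step Rw (app t u) (app t u′)

  SN : (Term S C → Term S C → Set) → Term S C → Set
  SN Rw = Acc (λ u t → Step Rw t u)

-- A (generalised) pure type system: sorts, axioms, rules, plus a
-- signature of typed constants and root rewrite rules.  An ordinary PTS
-- has no constants and no rewrite rules.

record System : Set₁ where
  field
    Sort  : Set
    Const : Set
    Ax    : Sort → Sort → Set
    Rl    : Sort → Sort → Sort → Set
    Decl  : Const → Set
    ty    : Const → Term Sort Const           -- its (closed) type
    Rw    : Term Sort Const → Term Sort Const → Set

module Typing (P : System) where
  open System P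

  Tm : Set
  Tm = Term Sort Const

  Ctx : Set
  Ctx = List Tm   -- head = most recently bound variable (index 0)

  _≃_ : Tm → Tm → Set
  _≃_ = EqClosure (Step Rw)

  infix 4 _⊢_∶_
  data _⊢_∶_ : Ctx → Tm → Tm → Set where
    axiom : ∀ {s₁ s₂} → Ax s₁ s₂ → [] ⊢ srt s₁ ∶ srt s₂
    const : ∀ {c s} → Decl c → [] ⊢ ty c ∶ srt s → [] ⊢ cst c ∶ ty c
    start : ∀ {Γ A s} → Γ ⊢ A ∶ srt s → (A ∷ Γ) ⊢ var zero ∶ shift A
    weak  : ∀ {Γ t T A s} → Γ ⊢ t ∶ T → Γ ⊢ A ∶ srt s →
            (A ∷ Γ) ⊢ shift t ∶ shift T
    prod  : ∀ {Γ A B s₁ s₂ s₃} → Rl s₁ s₂ s₃ →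
            Γ ⊢ A ∶ srt s₁ → (A ∷ Γ) ⊢ B ∶ srt s₂ → Γ ⊢ pi A B ∶ srt s₃
    abs   : ∀ {Γ A B b s} → (A ∷ Γ) ⊢ b ∶ B → Γ ⊢ pi A B ∶ srt s →
            Γ ⊢ lam A b ∶ pi A B
    appl  : ∀ {Γ A B f a} → Γ ⊢ f ∶ pi A B → Γ ⊢ a ∶ A →
            Γ ⊢ app f a ∶ (B [ a ])
    conv  : ∀ {Γ a A B s} → Γ ⊢ a ∶ A → Γ ⊢ B ∶ srt s → A ≃ B →
            Γ ⊢ a ∶ B

  Terminates : Set
  Terminates = ∀ {Γ t T} → Γ ⊢ t ∶ T → SN Rw t

NoRw : {S C : Set} → Term S C → Term S C → Set
NoRw _ _ = ⊥

PTS : (S : Set) → (S → S → Set) → (S → S → S → Set) → System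
PTS S A R = record
  { Sort = S ; Const = ⊥ ; Ax = A ; Rl = R
  ; Decl = λ () ; ty = λ () ; Rw = NoRw }

Functional : {S : Set} → (S → S → Set) → (S → S → S → Set) → Set
Functional {S} A R =
  (∀ {s₁ s₂ s₃ : S} → A s₁ s₂ → A s₁ s₃ → s₂ ≡ s₃) ×
  (∀ {s₁ s₂ s₃ s₄ : S} → R s₁ s₂ s₃ → R s₁ s₂ s₄ → s₃ ≡ s₄)

data LSort : Set where
  Type Kind : LSort

data LAx : LSort → LSort → Set where
  type:kind : LAx Type Kind

data LRl : LSort → LSort → LSort → Set where
  ttt : LRl Type Type Type
  tkk : LRl Type Kind Kind

module _ {S : Set} (A : S → S → Set) (R : S → S → S → Set) where

  data ΣC : Set where
    U    : S → ΣC
    ε    : S → ΣC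
    dot  : S → S → ΣC
    dotΠ : S → S → S → ΣC

  LTm : Set
  LTm = Term LSort ΣC

  ΣDecl : ΣC → Set
  ΣDecl (U s)           = ⊤
  ΣDecl (ε s)           = ⊤
  ΣDecl (dot s₁ s₂)     = A s₁ s₂
  ΣDecl (dotΠ s₁ s₂ s₃) = R s₁ s₂ s₃

  ΣTy : ΣC → LTm
  ΣTy (U s)           = srt Type
  ΣTy (ε s)           = pi (cst (U s)) (srt Type)
  ΣTy (dot s₁ s₂)     = cst (U s₂)
  ΣTy (dotΠ s₁ s₂ s₃) =                                         -- ΠX:U_{s₁}. ((ε_{s₁} X ⇒ U_{s₂}) ⇒ U_{s₃})
    pi (cst (U s₁))
       (pi (pi (app (cst (ε s₁)) (var zero)) (cst (U s₂)))
           (cst (U s₃)))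

  data ΣRw : LTm → LTm → Set where
    axRw : ∀ {s₁ s₂} → A s₁ s₂ →
           ΣRw (app (cst (ε s₂)) (cst (dot s₁ s₂))) (cst (U s₁))
    rlRw : ∀ {s₁ s₂ s₃ X Y} → R s₁ s₂ s₃ →
           ΣRw (app (cst (ε s₃)) (app (app (cst (dotΠ s₁ s₂ s₃)) X) Y))
               (pi (app (cst (ε s₁)) X)
                   (app (cst (ε s₂)) (app (shift Y) (var zero))))

  λΠ : System
  λΠ = record
    { Sort = LSort ; Const = ΣC ; Ax = LAx ; Rl = LRl
    ; Decl = ΣDecl ; ty = ΣTy ; Rw = ΣRw }

{-# OPTIONS --safe #-}
-- Translate P into λΠ_P: a sort s becomes ṡ, a product Πx:D. B with D : s₁,
-- B : s₂ becomes Π̇ ‖D‖ (λx:ε_{s₁} ‖D‖. ‖B‖), an abstraction λx:D. b becomes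
-- λx:ε_s ‖D‖. ‖b‖ where D : s, and a type T : s is read as ε_s ‖T‖ (a sort s
-- as U_s). Well-typed terms translate to well-typed terms, and every β-step
-- of a well-typed term is matched by at least one step of its translation,
-- so an infinite β-reduction in P would give one in λΠ_P. The translation
-- depends on the sorts of domains; functionality, through uniqueness of types
-- (which rests on confluence of β), keeps it well defined along reduction
-- and conversion.
module Submission where

open import Defs
open import Data.Nat using (ℕ; zero; suc)
open import Data.Empty using (⊥)
open import Data.List using ([]; _∷_)
open import Data.Unit using (⊤; tt)
open import Data.Sum using (_⊎_; inj₁; inj₂)
open import Data.Product using (∃; _×_; _,_; proj₁; proj₂)
open import Function.Base using (_∘_; flip)
open import Relation.Binary.PropositionalEquality
  using (_≡_; refl; sym; trans; cong; cong₂; subst₂; module ≡-Reasoning)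
  renaming (subst to transport)
open import Relation.Binary.Construct.Closure.ReflexiveTransitive using (Star; ε; _◅_; _◅◅_; gmap)
open import Relation.Binary.Construct.Closure.Symmetric using (fwd; bwd)
import Relation.Binary.Construct.Closure.Equivalence as Equivalence
open Equivalence using (EqClosure)
open import Relation.Binary.Construct.Closure.Equivalence.Properties using (a—↠b⇒a↔b; a—↠b⇒b↔a)
open import Relation.Binary.Rewriting using (Confluent)
open import Induction.WellFounded using (Acc; acc)

module _ {X Y : Set} {_⟶X_ : X → X → Set} {_⟶Y_ : Y → Y → Set} (Sim : X → Y → Set)
  (simulate : ∀ {x x′ y} → Sim x y → x ⟶X x′ →
              ∃ λ y′ → (∃ λ m → y ⟶Y m × Star _⟶Y_ m y′) × Sim x′ y′)
  where

  Acc-simulated : ∀ {x y} → Sim x y → Acc (flip _⟶Y_) y → Acc (flip _⟶X_) x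
  Acc-simulated sim accY = go accY ε sim
    where
    go : ∀ {x y₀ y} → Acc (flip _⟶Y_) y₀ → Star _⟶Y_ y₀ y → Sim x y → Acc (flip _⟶X_) x
    go (acc rs) (s ◅ r) sim = go (rs s) r sim
    go (acc rs) ε sim = acc λ step → let _ , (_ , s , r) , sim′ = simulate sim step in go (rs s) r sim′

module _ {S C : Set} where

  private
    Tm : Set
    Tm = Term S C

    -- `ext` only acts on ℕ, so its parameters S and C must be fixed by hand.
    ext′ : (ℕ → ℕ) → ℕ → ℕ
    ext′ = ext {S} {C}

  single : Tm → ℕ → Tm
  single u zero    = u
  single u (suc n) = var n

  exts-cong : ∀ {σ τ : ℕ → Tm} → (∀ n → σ n ≡ τ n) → ∀ n → exts σ n ≡ exts τ n
  exts-cong h zero    = refl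
  exts-cong h (suc n) = cong shift (h n)

  subst-cong : ∀ {σ τ : ℕ → Tm} → (∀ n → σ n ≡ τ n) → (t : Tm) → subst σ t ≡ subst τ t
  subst-cong h (var n)   = h n
  subst-cong h (srt s)   = refl
  subst-cong h (cst c)   = refl
  subst-cong h (pi A B)  = cong₂ pi (subst-cong h A) (subst-cong (exts-cong h) B)
  subst-cong h (lam A b) = cong₂ lam (subst-cong h A) (subst-cong (exts-cong h) b)
  subst-cong h (app t u) = cong₂ app (subst-cong h t) (subst-cong h u)

  exts-id : ∀ {σ : ℕ → Tm} → (∀ n → σ n ≡ var n) → ∀ n → exts σ n ≡ var n
  exts-id h zero    = refl
  exts-id h (suc n) = cong shift (h n)

  subst-id : ∀ {σ : ℕ → Tm} → (∀ n → σ n ≡ var n) → (t : Tm) → subst σ t ≡ t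
  subst-id h (var n)   = h n
  subst-id h (srt s)   = refl
  subst-id h (cst c)   = refl
  subst-id h (pi A B)  = cong₂ pi (subst-id h A) (subst-id (exts-id h) B)
  subst-id h (lam A b) = cong₂ lam (subst-id h A) (subst-id (exts-id h) b)
  subst-id h (app t u) = cong₂ app (subst-id h t) (subst-id h u)

  ext-∘ : ∀ {ρ ρ′ ρ″ : ℕ → ℕ} → (∀ n → ρ′ (ρ n) ≡ ρ″ n) → ∀ n → ext′ ρ′ (ext′ ρ n) ≡ ext′ ρ″ n
  ext-∘ h zero    = refl
  ext-∘ h (suc n) = cong suc (h n)

  rename-∘ : ∀ {ρ ρ′ ρ″ : ℕ → ℕ} → (∀ n → ρ′ (ρ n) ≡ ρ″ n) →
             (t : Tm) → rename ρ′ (rename ρ t) ≡ rename ρ″ t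
  rename-∘ h (var n)   = cong var (h n)
  rename-∘ h (srt s)   = refl
  rename-∘ h (cst c)   = refl
  rename-∘ h (pi A B)  = cong₂ pi (rename-∘ h A) (rename-∘ (ext-∘ h) B)
  rename-∘ h (lam A b) = cong₂ lam (rename-∘ h A) (rename-∘ (ext-∘ h) b)
  rename-∘ h (app t u) = cong₂ app (rename-∘ h t) (rename-∘ h u)

  ext-as-exts : ∀ {ρ : ℕ → ℕ} {σ : ℕ → Tm} → (∀ n → var (ρ n) ≡ σ n) →
                ∀ n → var (ext′ ρ n) ≡ exts σ n
  ext-as-exts h zero    = refl
  ext-as-exts h (suc n) = cong shift (h n)

  rename-as-subst : ∀ {ρ : ℕ → ℕ} {σ : ℕ → Tm} → (∀ n → var (ρ n) ≡ σ n) →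
                    (t : Tm) → rename ρ t ≡ subst σ t
  rename-as-subst h (var n)   = h n
  rename-as-subst h (srt s)   = refl
  rename-as-subst h (cst c)   = refl
  rename-as-subst h (pi A B)  = cong₂ pi (rename-as-subst h A) (rename-as-subst (ext-as-exts h) B)
  rename-as-subst h (lam A b) = cong₂ lam (rename-as-subst h A) (rename-as-subst (ext-as-exts h) b)
  rename-as-subst h (app t u) = cong₂ app (rename-as-subst h t) (rename-as-subst h u)

  exts-∘-ext : ∀ {ρ : ℕ → ℕ} {σ τ : ℕ → Tm} → (∀ n → σ (ρ n) ≡ τ n) →
             ∀ n → exts σ (ext′ ρ n) ≡ exts τ n
  exts-∘-ext h zero    = refl
  exts-∘-ext h (suc n) = cong shift (h n)

  subst-rename : ∀ {ρ : ℕ → ℕ} {σ τ : ℕ → Tm} → (∀ n → σ (ρ n) ≡ τ n) →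
                 (t : Tm) → subst σ (rename ρ t) ≡ subst τ t
  subst-rename h (var n)   = h n
  subst-rename h (srt s)   = refl
  subst-rename h (cst c)   = refl
  subst-rename h (pi A B)  = cong₂ pi (subst-rename h A) (subst-rename (exts-∘-ext h) B)
  subst-rename h (lam A b) = cong₂ lam (subst-rename h A) (subst-rename (exts-∘-ext h) b)
  subst-rename h (app t u) = cong₂ app (subst-rename h t) (subst-rename h u)

  ext-∘-exts : ∀ {ρ : ℕ → ℕ} {σ τ : ℕ → Tm} → (∀ n → rename ρ (σ n) ≡ τ n) →
             ∀ n → rename (ext′ ρ) (exts σ n) ≡ exts τ n
  ext-∘-exts h zero    = refl
  ext-∘-exts {ρ} {σ} h (suc n) = begin
    rename (ext′ ρ) (shift (σ n)) ≡⟨ rename-∘ (λ _ → refl) (σ n) ⟩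
    rename (suc ∘ ρ) (σ n)       ≡⟨ rename-∘ (λ _ → refl) (σ n) ⟨
    shift (rename ρ (σ n))       ≡⟨ cong shift (h n) ⟩
    shift _ ∎
    where open ≡-Reasoning

  rename-subst : ∀ {ρ : ℕ → ℕ} {σ τ : ℕ → Tm} → (∀ n → rename ρ (σ n) ≡ τ n) →
                 (t : Tm) → rename ρ (subst σ t) ≡ subst τ t
  rename-subst h (var n)   = h n
  rename-subst h (srt s)   = refl
  rename-subst h (cst c)   = refl
  rename-subst h (pi A B)  = cong₂ pi (rename-subst h A) (rename-subst (ext-∘-exts h) B)
  rename-subst h (lam A b) = cong₂ lam (rename-subst h A) (rename-subst (ext-∘-exts h) b)
  rename-subst h (app t u) = cong₂ app (rename-subst h t) (rename-subst h u)

  shift-subst : (σ : ℕ → Tm) (t : Tm) → shift (subst σ t) ≡ subst (shift ∘ σ) t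
  shift-subst σ = rename-subst (λ _ → refl)

  subst-exts-shift : (σ : ℕ → Tm) (t : Tm) → subst (exts σ) (shift t) ≡ shift (subst σ t)
  subst-exts-shift σ t = trans (subst-rename (λ _ → refl) t) (sym (shift-subst σ t))

  exts-∘ : ∀ {σ τ υ : ℕ → Tm} → (∀ n → subst τ (σ n) ≡ υ n) →
           ∀ n → subst (exts τ) (exts σ n) ≡ exts υ n
  exts-∘ h zero    = refl
  exts-∘ {σ} {τ} h (suc n) = begin
    subst (exts τ) (shift (σ n)) ≡⟨ subst-exts-shift τ (σ n) ⟩
    shift (subst τ (σ n))        ≡⟨ cong shift (h n) ⟩
    shift _ ∎
    where open ≡-Reasoning

  subst-∘ : ∀ {σ τ υ : ℕ → Tm} → (∀ n → subst τ (σ n) ≡ υ n) →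
            (t : Tm) → subst τ (subst σ t) ≡ subst υ t
  subst-∘ h (var n)   = h n
  subst-∘ h (srt s)   = refl
  subst-∘ h (cst c)   = refl
  subst-∘ h (pi A B)  = cong₂ pi (subst-∘ h A) (subst-∘ (exts-∘ h) B)
  subst-∘ h (lam A b) = cong₂ lam (subst-∘ h A) (subst-∘ (exts-∘ h) b)
  subst-∘ h (app t u) = cong₂ app (subst-∘ h t) (subst-∘ h u)

  []-as-single : (t u : Tm) → t [ u ] ≡ subst (single u) t
  []-as-single t u = subst-cong (λ { zero → refl ; (suc n) → refl }) t

  single-shift : (t u : Tm) → subst (single u) (shift t) ≡ t
  single-shift t u = trans (subst-rename (λ _ → refl) t) (subst-id (λ _ → refl) t)

  subst-single : (σ : ℕ → Tm) (t u : Tm) →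
                 subst σ (subst (single u) t) ≡ subst (single (subst σ u)) (subst (exts σ) t)
  subst-single σ t u = trans (subst-∘ (λ _ → refl) t) (sym (subst-∘ h t))
    where h : ∀ n → subst (single (subst σ u)) (exts σ n) ≡ subst σ (single u n)
          h zero    = refl
          h (suc n) = single-shift (σ n) (subst σ u)

  subst-[] : (σ : ℕ → Tm) (t u : Tm) → subst σ (t [ u ]) ≡ subst (exts σ) t [ subst σ u ]
  subst-[] σ t u = begin
    subst σ (t [ u ])                               ≡⟨ cong (subst σ) ([]-as-single t u) ⟩
    subst σ (subst (single u) t)                    ≡⟨ subst-single σ t u ⟩
    subst (single (subst σ u)) (subst (exts σ) t)   ≡⟨ []-as-single (subst (exts σ) t) (subst σ u) ⟨
    subst (exts σ) t [ subst σ u ] ∎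
    where open ≡-Reasoning

  rename-single : (ρ : ℕ → ℕ) (t u : Tm) →
                  rename ρ (subst (single u) t) ≡ subst (single (rename ρ u)) (rename (ext′ ρ) t)
  rename-single ρ t u = trans (rename-subst (λ _ → refl) t) (sym (subst-rename h t))
    where h : ∀ n → single (rename ρ u) (ext′ ρ n) ≡ rename ρ (single u n)
          h zero    = refl
          h (suc n) = refl

  rename-[] : (ρ : ℕ → ℕ) (t u : Tm) → rename ρ (t [ u ]) ≡ rename (ext′ ρ) t [ rename ρ u ]
  rename-[] ρ t u = begin
    rename ρ (t [ u ])                              ≡⟨ cong (rename ρ) ([]-as-single t u) ⟩
    rename ρ (subst (single u) t)                   ≡⟨ rename-single ρ t u ⟩
    subst (single (rename ρ u)) (rename (ext′ ρ) t) ≡⟨ []-as-single (rename (ext′ ρ) t) (rename ρ u) ⟨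
    rename (ext′ ρ) t [ rename ρ u ] ∎
    where open ≡-Reasoning

  rename-ext-suc-[var-zero] : (t : Tm) → rename (ext′ suc) t [ var zero ] ≡ t
  rename-ext-suc-[var-zero] t = begin
    rename (ext′ suc) t [ var zero ]                ≡⟨ []-as-single (rename (ext′ suc) t) (var zero) ⟩
    subst (single (var zero)) (rename (ext′ suc) t) ≡⟨ subst-rename h t ⟩
    subst var t                                     ≡⟨ subst-id (λ _ → refl) t ⟩
    t ∎
    where open ≡-Reasoning
          h : ∀ n → single (var zero) (ext′ suc n) ≡ var n
          h zero    = refl
          h (suc n) = refl

  infix 4 _⟶β_ _↠β_ _=β_

  _⟶β_ : Tm → Tm → Set
  _⟶β_ = Step NoRw

  _↠β_ : Tm → Tm → Set
  _↠β_ = Star _⟶β_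

  _=β_ : Tm → Tm → Set
  _=β_ = EqClosure _⟶β_

  ↠-pi : ∀ {A A′ B B′} → A ↠β A′ → B ↠β B′ → pi A B ↠β pi A′ B′
  ↠-pi {A′ = A′} {B} r₁ r₂ = gmap (λ x → pi x B) piL r₁ ◅◅ gmap (pi A′) piR r₂

  ↠-lam : ∀ {A A′ b b′} → A ↠β A′ → b ↠β b′ → lam A b ↠β lam A′ b′
  ↠-lam {A′ = A′} {b} r₁ r₂ = gmap (λ x → lam x b) lamL r₁ ◅◅ gmap (lam A′) lamR r₂

  ↠-app : ∀ {t t′ u u′} → t ↠β t′ → u ↠β u′ → app t u ↠β app t′ u′
  ↠-app {t′ = t′} {u} r₁ r₂ = gmap (λ x → app x u) appL r₁ ◅◅ gmap (app t′) appR r₂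

  infix 4 _⇛_
  data _⇛_ : Tm → Tm → Set where
    ⇛var : ∀ {n} → var n ⇛ var n
    ⇛srt : ∀ {s} → srt s ⇛ srt s
    ⇛cst : ∀ {c} → cst c ⇛ cst c
    ⇛pi  : ∀ {A A′ B B′} → A ⇛ A′ → B ⇛ B′ → pi A B ⇛ pi A′ B′
    ⇛lam : ∀ {A A′ b b′} → A ⇛ A′ → b ⇛ b′ → lam A b ⇛ lam A′ b′
    ⇛app : ∀ {t t′ u u′} → t ⇛ t′ → u ⇛ u′ → app t u ⇛ app t′ u′
    ⇛β   : ∀ {A b b′ u u′} → b ⇛ b′ → u ⇛ u′ → app (lam A b) u ⇛ subst (single u′) b′

  ⇛-refl : (t : Tm) → t ⇛ t
  ⇛-refl (var n)   = ⇛var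
  ⇛-refl (srt s)   = ⇛srt
  ⇛-refl (cst c)   = ⇛cst
  ⇛-refl (pi A B)  = ⇛pi (⇛-refl A) (⇛-refl B)
  ⇛-refl (lam A b) = ⇛lam (⇛-refl A) (⇛-refl b)
  ⇛-refl (app t u) = ⇛app (⇛-refl t) (⇛-refl u)

  ⟶β⇒⇛ : ∀ {t u} → t ⟶β u → t ⇛ u
  ⟶β⇒⇛ (beta {b = b} {u}) =
    subst₂ _⇛_ refl (sym ([]-as-single b u)) (⇛β (⇛-refl b) (⇛-refl u))
  ⟶β⇒⇛ (piL s)  = ⇛pi (⟶β⇒⇛ s) (⇛-refl _)
  ⟶β⇒⇛ (piR s)  = ⇛pi (⇛-refl _) (⟶β⇒⇛ s)
  ⟶β⇒⇛ (lamL s) = ⇛lam (⟶β⇒⇛ s) (⇛-refl _)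
  ⟶β⇒⇛ (lamR s) = ⇛lam (⇛-refl _) (⟶β⇒⇛ s)
  ⟶β⇒⇛ (appL s) = ⇛app (⟶β⇒⇛ s) (⇛-refl _)
  ⟶β⇒⇛ (appR s) = ⇛app (⇛-refl _) (⟶β⇒⇛ s)

  ⇛⇒↠β : ∀ {t u} → t ⇛ u → t ↠β u
  ⇛⇒↠β ⇛var        = ε
  ⇛⇒↠β ⇛srt        = ε
  ⇛⇒↠β ⇛cst        = ε
  ⇛⇒↠β (⇛pi p q)   = ↠-pi (⇛⇒↠β p) (⇛⇒↠β q)
  ⇛⇒↠β (⇛lam p q)  = ↠-lam (⇛⇒↠β p) (⇛⇒↠β q)
  ⇛⇒↠β (⇛app p q)  = ↠-app (⇛⇒↠β p) (⇛⇒↠β q)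
  ⇛⇒↠β (⇛β {b′ = b′} {u′ = u′} p q) =
    ↠-app (↠-lam ε (⇛⇒↠β p)) (⇛⇒↠β q) ◅◅
    subst₂ _⟶β_ refl ([]-as-single b′ u′) beta ◅ ε

  ⇛-rename : ∀ (ρ : ℕ → ℕ) {t t′} → t ⇛ t′ → rename ρ t ⇛ rename ρ t′
  ⇛-rename ρ ⇛var       = ⇛var
  ⇛-rename ρ ⇛srt       = ⇛srt
  ⇛-rename ρ ⇛cst       = ⇛cst
  ⇛-rename ρ (⇛pi p q)  = ⇛pi (⇛-rename ρ p) (⇛-rename (ext′ ρ) q)
  ⇛-rename ρ (⇛lam p q) = ⇛lam (⇛-rename ρ p) (⇛-rename (ext′ ρ) q)
  ⇛-rename ρ (⇛app p q) = ⇛app (⇛-rename ρ p) (⇛-rename ρ q)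
  ⇛-rename ρ (⇛β {b′ = b′} {u′ = u′} p q) =
    subst₂ _⇛_ refl (sym (rename-single ρ b′ u′)) (⇛β (⇛-rename (ext′ ρ) p) (⇛-rename ρ q))

  ⇛-exts : ∀ {σ σ′ : ℕ → Tm} → (∀ n → σ n ⇛ σ′ n) → ∀ n → exts σ n ⇛ exts σ′ n
  ⇛-exts h zero    = ⇛var
  ⇛-exts h (suc n) = ⇛-rename suc (h n)

  ⇛-subst : ∀ {σ σ′ : ℕ → Tm} → (∀ n → σ n ⇛ σ′ n) → ∀ {t t′} → t ⇛ t′ → subst σ t ⇛ subst σ′ t′
  ⇛-subst h (⇛var {n}) = h n
  ⇛-subst h ⇛srt       = ⇛srt
  ⇛-subst h ⇛cst       = ⇛cst
  ⇛-subst h (⇛pi p q)  = ⇛pi (⇛-subst h p) (⇛-subst (⇛-exts h) q)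
  ⇛-subst h (⇛lam p q) = ⇛lam (⇛-subst h p) (⇛-subst (⇛-exts h) q)
  ⇛-subst h (⇛app p q) = ⇛app (⇛-subst h p) (⇛-subst h q)
  ⇛-subst {σ′ = σ′} h (⇛β {b′ = b′} {u′ = u′} p q) =
    subst₂ _⇛_ refl (sym (subst-single σ′ b′ u′)) (⇛β (⇛-subst (⇛-exts h) p) (⇛-subst h q))

  ⇛-single : ∀ {b b′ u u′} → b ⇛ b′ → u ⇛ u′ → subst (single u) b ⇛ subst (single u′) b′
  ⇛-single p q = ⇛-subst (λ { zero → q ; (suc n) → ⇛var }) p

  develop : Tm → Tm
  develop (var n)           = var n
  develop (srt s)           = srt s
  develop (cst c)           = cst c
  develop (pi A B)          = pi (develop A) (develop B)
  develop (lam A b)         = lam (develop A) (develop b)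
  develop (app (lam A b) u) = subst (single (develop u)) (develop b)
  develop (app t u)         = app (develop t) (develop u)

  ⇛-develop : ∀ {t u} → t ⇛ u → u ⇛ develop t
  ⇛-develop ⇛var                  = ⇛var
  ⇛-develop ⇛srt                  = ⇛srt
  ⇛-develop ⇛cst                  = ⇛cst
  ⇛-develop (⇛pi p q)             = ⇛pi (⇛-develop p) (⇛-develop q)
  ⇛-develop (⇛lam p q)            = ⇛lam (⇛-develop p) (⇛-develop q)
  ⇛-develop (⇛β p q)              = ⇛-single (⇛-develop p) (⇛-develop q)
  ⇛-develop (⇛app (⇛lam _ p) q)   = ⇛β (⇛-develop p) (⇛-develop q)
  ⇛-develop (⇛app ⇛var q)         = ⇛app ⇛var (⇛-develop q)
  ⇛-develop (⇛app ⇛srt q)         = ⇛app ⇛srt (⇛-develop q)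
  ⇛-develop (⇛app ⇛cst q)         = ⇛app ⇛cst (⇛-develop q)
  ⇛-develop (⇛app p@(⇛pi _ _) q)  = ⇛app (⇛-develop p) (⇛-develop q)
  ⇛-develop (⇛app p@(⇛app _ _) q) = ⇛app (⇛-develop p) (⇛-develop q)
  ⇛-develop (⇛app p@(⇛β _ _) q)   = ⇛app (⇛-develop p) (⇛-develop q)

  ⇛-strip : ∀ {t u v} → t ⇛ u → Star _⇛_ t v → ∃ λ w → Star _⇛_ u w × v ⇛ w
  ⇛-strip p ε = _ , ε , p
  ⇛-strip p (q ◅ r) with ⇛-strip (⇛-develop q) r
  ... | w , r′ , q′ = w , ⇛-develop p ◅ r′ , q′

  ⇛-confluent : Confluent _⇛_
  ⇛-confluent ε r = _ , r , ε
  ⇛-confluent (p ◅ r₁) r₂ with ⇛-strip p r₂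
  ... | w , r′ , q with ⇛-confluent r₁ r′
  ... | w′ , a , b = w′ , a , q ◅ b

  ⟶β-confluent : Confluent _⟶β_
  ⟶β-confluent r₁ r₂ with ⇛-confluent (gmap _ ⟶β⇒⇛ r₁) (gmap _ ⟶β⇒⇛ r₂)
  ... | w , a , b = w , ⇛*⇒↠β a , ⇛*⇒↠β b
    where ⇛*⇒↠β : ∀ {t u} → Star _⇛_ t u → t ↠β u
          ⇛*⇒↠β ε       = ε
          ⇛*⇒↠β (p ◅ r) = ⇛⇒↠β p ◅◅ ⇛*⇒↠β r

  =β⇒joinable : ∀ {t u} → t =β u → ∃ λ w → t ↠β w × u ↠β w
  =β⇒joinable ε = _ , ε , ε
  =β⇒joinable (fwd s ◅ c) with =β⇒joinable c
  ... | w , a , b = w , s ◅ a , b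
  =β⇒joinable (bwd s ◅ c) with =β⇒joinable c
  ... | w , a , b with ⟶β-confluent (s ◅ ε) a
  ... | w′ , x , y = w′ , x , b ◅◅ y

  joinable⇒=β : ∀ {t u w} → t ↠β w → u ↠β w → t =β u
  joinable⇒=β a b = a—↠b⇒a↔b a ◅◅ a—↠b⇒b↔a b

  ↠β-srt : ∀ {s t} → srt s ↠β t → t ≡ srt s
  ↠β-srt ε            = refl
  ↠β-srt (rw () ◅ _)

  ↠β-pi : ∀ {A B t} → pi A B ↠β t → ∃ λ A′ → ∃ λ B′ → t ≡ pi A′ B′ × A ↠β A′ × B ↠β B′
  ↠β-pi ε = _ , _ , refl , ε , ε
  ↠β-pi (rw () ◅ _)
  ↠β-pi (piL s ◅ r) with ↠β-pi r
  ... | A′ , B′ , e , a , b = A′ , B′ , e , s ◅ a , b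
  ↠β-pi (piR s ◅ r) with ↠β-pi r
  ... | A′ , B′ , e , a , b = A′ , B′ , e , a , s ◅ b

  srt-injective : ∀ {s s′} → srt s =β srt s′ → s ≡ s′
  srt-injective c with =β⇒joinable c
  ... | _ , a , b with trans (sym (↠β-srt a)) (↠β-srt b)
  ... | refl = refl

  pi-injective : ∀ {A B A′ B′} → pi A B =β pi A′ B′ → A =β A′ × B =β B′
  pi-injective c with =β⇒joinable c
  ... | _ , a , b with ↠β-pi a | ↠β-pi b
  ... | _ , _ , refl , a₁ , b₁ | _ , _ , refl , a₂ , b₂ =
        joinable⇒=β a₁ a₂ , joinable⇒=β b₁ b₂

  ⟶β-rename⁻¹ : ∀ (ρ : ℕ → ℕ) (t : Tm) {u} → rename ρ t ⟶β u → ∃ λ t′ → t ⟶β t′ × u ≡ rename ρ t′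
  ⟶β-rename⁻¹ ρ (app (lam A b) a) beta = b [ a ] , beta , sym (rename-[] ρ b a)
  ⟶β-rename⁻¹ ρ (pi A B) (piL s) with ⟶β-rename⁻¹ ρ A s
  ... | A′ , s′ , refl = pi A′ B , piL s′ , refl
  ⟶β-rename⁻¹ ρ (pi A B) (piR s) with ⟶β-rename⁻¹ (ext′ ρ) B s
  ... | B′ , s′ , refl = pi A B′ , piR s′ , refl
  ⟶β-rename⁻¹ ρ (lam A b) (lamL s) with ⟶β-rename⁻¹ ρ A s
  ... | A′ , s′ , refl = lam A′ b , lamL s′ , refl
  ⟶β-rename⁻¹ ρ (lam A b) (lamR s) with ⟶β-rename⁻¹ (ext′ ρ) b s
  ... | b′ , s′ , refl = lam A b′ , lamR s′ , refl
  ⟶β-rename⁻¹ ρ (app t a) (appL s) with ⟶β-rename⁻¹ ρ t s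
  ... | t′ , s′ , refl = app t′ a , appL s′ , refl
  ⟶β-rename⁻¹ ρ (app t a) (appR s) with ⟶β-rename⁻¹ ρ a s
  ... | a′ , s′ , refl = app t a′ , appR s′ , refl
  ⟶β-rename⁻¹ ρ _ (rw ())

  []-↠β : ∀ B {a a′} → a ⟶β a′ → B [ a ] ↠β B [ a′ ]
  []-↠β B {a} {a′} s = subst₂ _↠β_ (sym ([]-as-single B a)) (sym ([]-as-single B a′))
    (⇛⇒↠β (⇛-single (⇛-refl B) (⟶β⇒⇛ s)))

module Metatheory (P : System)
  (Rw-subst : ∀ (σ : ℕ → Term (System.Sort P) (System.Const P)) {t u} →
              System.Rw P t u → System.Rw P (subst σ t) (subst σ u))
  (ty-closed : ∀ c (σ : ℕ → Term (System.Sort P) (System.Const P)) → subst σ (System.ty P c) ≡ System.ty P c)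
  where
  open System P
  open Typing P

  private
    ext′ : (ℕ → ℕ) → ℕ → ℕ
    ext′ = ext {Sort} {Const}

  ≃-sym : ∀ {t u} → t ≃ u → u ≃ t
  ≃-sym = Equivalence.symmetric (Step Rw)

  ⟶-subst : ∀ (σ : ℕ → Tm) {t u} → Step Rw t u → Step Rw (subst σ t) (subst σ u)
  ⟶-subst σ (beta {b = b} {u}) = subst₂ (Step Rw) refl (sym (subst-[] σ b u)) beta
  ⟶-subst σ (rw r)   = rw (Rw-subst σ r)
  ⟶-subst σ (piL s)  = piL (⟶-subst σ s)
  ⟶-subst σ (piR s)  = piR (⟶-subst (exts σ) s)
  ⟶-subst σ (lamL s) = lamL (⟶-subst σ s)
  ⟶-subst σ (lamR s) = lamR (⟶-subst (exts σ) s)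
  ⟶-subst σ (appL s) = appL (⟶-subst σ s)
  ⟶-subst σ (appR s) = appR (⟶-subst σ s)

  ≃-subst : ∀ (σ : ℕ → Tm) {t u} → t ≃ u → subst σ t ≃ subst σ u
  ≃-subst σ = Equivalence.gmap (subst σ) (⟶-subst σ)

  ≃-shift : ∀ {t u} → t ≃ u → shift t ≃ shift u
  ≃-shift {t} {u} c =
    subst₂ _≃_ (sym (rename-as-subst (λ _ → refl) t)) (sym (rename-as-subst (λ _ → refl) u))
      (≃-subst (var ∘ suc) c)

  ⊢-cast : ∀ {Γ t t′ T T′} → t ≡ t′ → T ≡ T′ → Γ ⊢ t ∶ T → Γ ⊢ t′ ∶ T′
  ⊢-cast refl refl d = d

  WfCtx : Ctx → Set
  WfCtx []      = ⊤
  WfCtx (A ∷ Γ) = ∃ λ s → Γ ⊢ A ∶ srt s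

  ⊢-wfCtx : ∀ {Γ t T} → Γ ⊢ t ∶ T → WfCtx Γ
  ⊢-wfCtx (axiom _)    = tt
  ⊢-wfCtx (const _ _)  = tt
  ⊢-wfCtx (start d)    = _ , d
  ⊢-wfCtx (weak _ d)   = _ , d
  ⊢-wfCtx (prod _ d _) = ⊢-wfCtx d
  ⊢-wfCtx (abs _ d)    = ⊢-wfCtx d
  ⊢-wfCtx (appl d _)   = ⊢-wfCtx d
  ⊢-wfCtx (conv d _ _) = ⊢-wfCtx d

  ⊢-axiom : ∀ {Γ s₁ s₂} → WfCtx Γ → Ax s₁ s₂ → Γ ⊢ srt s₁ ∶ srt s₂
  ⊢-axiom {[]}    _        a = axiom a
  ⊢-axiom {_ ∷ _} (_ , dA) a = weak (⊢-axiom (⊢-wfCtx dA) a) dA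

  ⊢-const : ∀ {Γ c s} → WfCtx Γ → Decl c → [] ⊢ ty c ∶ srt s → Γ ⊢ cst c ∶ ty c
  ⊢-const {[]}        _        d dt = const d dt
  ⊢-const {_ ∷ _} {c} (_ , dA) d dt =
    ⊢-cast refl (trans (rename-as-subst (λ _ → refl) (ty c)) (ty-closed c _))
      (weak (⊢-const (⊢-wfCtx dA) d dt) dA)

  infix 4 _⊢ˢ_∶_
  data _⊢ˢ_∶_ (Δ : Ctx) : (ℕ → Tm) → Ctx → Set where
    []ˢ  : ∀ {σ} → WfCtx Δ → Δ ⊢ˢ σ ∶ []
    _∷ˢ_ : ∀ {σ Γ A} → Δ ⊢ˢ σ ∘ suc ∶ Γ → Δ ⊢ σ zero ∶ subst (σ ∘ suc) A → Δ ⊢ˢ σ ∶ A ∷ Γ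

  ⊢ˢ-wfCtx : ∀ {Δ σ Γ} → Δ ⊢ˢ σ ∶ Γ → WfCtx Δ
  ⊢ˢ-wfCtx ([]ˢ w)  = w
  ⊢ˢ-wfCtx (_ ∷ˢ d) = ⊢-wfCtx d

  ⊢ˢ-weaken : ∀ {Δ σ Γ B s} → Δ ⊢ˢ σ ∶ Γ → Δ ⊢ B ∶ srt s → B ∷ Δ ⊢ˢ shift ∘ σ ∶ Γ
  ⊢ˢ-weaken ([]ˢ _) dB = []ˢ (_ , dB)
  ⊢ˢ-weaken {σ = σ} (_∷ˢ_ {A = A} h d) dB =
    ⊢ˢ-weaken h dB ∷ˢ ⊢-cast refl (shift-subst (σ ∘ suc) A) (weak d dB)

  ⊢ˢ-exts : ∀ {Δ σ Γ A s} → Δ ⊢ˢ σ ∶ Γ → Δ ⊢ subst σ A ∶ srt s → subst σ A ∷ Δ ⊢ˢ exts σ ∶ A ∷ Γ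
  ⊢ˢ-exts {σ = σ} {A = A} h d = ⊢ˢ-weaken h d ∷ˢ ⊢-cast refl (shift-subst σ A) (start d)

  -- The subject of `weak` is `shift t`, on which Agda cannot match, so the
  -- inversion lemmas below take the shape of the subject as an equation.
  pi-domain-sorted : ∀ {Γ t T A B} → Γ ⊢ t ∶ T → t ≡ pi A B → ∃ λ s → Γ ⊢ A ∶ srt s
  pi-domain-sorted (prod _ dA _) refl = _ , dA
  pi-domain-sorted (weak {t = pi _ _} d dC) refl with pi-domain-sorted d refl
  ... | s , dA = s , weak dA dC
  pi-domain-sorted (conv d _ _) e = pi-domain-sorted d e
  pi-domain-sorted (axiom _) ()
  pi-domain-sorted (const _ _) ()
  pi-domain-sorted (start _) ()
  pi-domain-sorted (abs _ _) ()
  pi-domain-sorted (appl _ _) ()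
  pi-domain-sorted (weak {t = var _} _ _) ()
  pi-domain-sorted (weak {t = srt _} _ _) ()
  pi-domain-sorted (weak {t = cst _} _ _) ()
  pi-domain-sorted (weak {t = lam _ _} _ _) ()
  pi-domain-sorted (weak {t = app _ _} _ _) ()

  ⊢-subst : ∀ {Γ t T} → Γ ⊢ t ∶ T → ∀ {Δ σ} → Δ ⊢ˢ σ ∶ Γ → Δ ⊢ subst σ t ∶ subst σ T
  ⊢-subst (axiom a) h = ⊢-axiom (⊢ˢ-wfCtx h) a
  ⊢-subst (const {c} d dt) {σ = σ} h = ⊢-cast refl (sym (ty-closed c σ)) (⊢-const (⊢ˢ-wfCtx h) d dt)
  ⊢-subst (start {A = A} _) {σ = σ} (_ ∷ˢ d) = ⊢-cast refl (sym (subst-rename (λ _ → refl) A)) d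
  ⊢-subst (weak {t = t} {T} d _) {σ = σ} (h ∷ˢ _) =
    ⊢-cast (sym (subst-rename (λ _ → refl) t)) (sym (subst-rename (λ _ → refl) T)) (⊢-subst d h)
  ⊢-subst (prod r dA dB) h = prod r dA′ (⊢-subst dB (⊢ˢ-exts h dA′))
    where dA′ = ⊢-subst dA h
  ⊢-subst (abs db dpi) h with ⊢-subst dpi h
  ... | dpi′ with pi-domain-sorted dpi′ refl
  ... | _ , dA′ = abs (⊢-subst db (⊢ˢ-exts h dA′)) dpi′
  ⊢-subst (appl {B = B} {a = a} df da) {σ = σ} h =
    ⊢-cast refl (sym (subst-[] σ B a)) (appl (⊢-subst df h) (⊢-subst da h))
  ⊢-subst (conv d dB c) {σ = σ} h = conv (⊢-subst d h) (⊢-subst dB h) (≃-subst σ c)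

  ⊢ˢ-id : ∀ {Γ} → WfCtx Γ → Γ ⊢ˢ var ∶ Γ
  ⊢ˢ-id {[]}    _          = []ˢ tt
  ⊢ˢ-id {A ∷ Γ} (_ , dA) =
    ⊢ˢ-weaken (⊢ˢ-id (⊢-wfCtx dA)) dA ∷ˢ ⊢-cast refl (rename-as-subst (λ _ → refl) A) (start dA)

  ⊢ˢ-wk : ∀ {Γ A s} → Γ ⊢ A ∶ srt s → A ∷ Γ ⊢ˢ var ∘ suc ∶ Γ
  ⊢ˢ-wk dA = ⊢ˢ-weaken (⊢ˢ-id (⊢-wfCtx dA)) dA

  ⊢ˢ-single : ∀ {Γ u A} → Γ ⊢ u ∶ A → Γ ⊢ˢ single u ∶ A ∷ Γ
  ⊢ˢ-single {A = A} du = ⊢ˢ-id (⊢-wfCtx du) ∷ˢ ⊢-cast refl (sym (subst-id (λ _ → refl) A)) du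

  ⊢-rename : ∀ {Γ Δ t T} (ρ : ℕ → ℕ) → Γ ⊢ t ∶ T → Δ ⊢ˢ var ∘ ρ ∶ Γ → Δ ⊢ rename ρ t ∶ rename ρ T
  ⊢-rename {t = t} {T} ρ d h =
    ⊢-cast (sym (rename-as-subst (λ _ → refl) t)) (sym (rename-as-subst (λ _ → refl) T)) (⊢-subst d h)

  ⊢ˢ-ext : ∀ {Δ Γ A s} (ρ : ℕ → ℕ) → Δ ⊢ˢ var ∘ ρ ∶ Γ → Δ ⊢ rename ρ A ∶ srt s →
           rename ρ A ∷ Δ ⊢ˢ var ∘ ext′ ρ ∶ A ∷ Γ
  ⊢ˢ-ext {A = A} ρ h d = ⊢ˢ-weaken h d ∷ˢ
    ⊢-cast refl (trans (rename-∘ (λ _ → refl) A) (rename-as-subst (λ _ → refl) A)) (start d)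

  ⊢-[] : ∀ {Γ A b B u} → A ∷ Γ ⊢ b ∶ B → Γ ⊢ u ∶ A → Γ ⊢ b [ u ] ∶ B [ u ]
  ⊢-[] {b = b} {B} {u} d du =
    ⊢-cast (sym ([]-as-single b u)) (sym ([]-as-single B u)) (⊢-subst d (⊢ˢ-single du))

  ⊢ˢ-ctx-conv : ∀ {Γ A A′ s s′} → Γ ⊢ A′ ∶ srt s′ → Γ ⊢ A ∶ srt s → A′ ≃ A → A′ ∷ Γ ⊢ˢ var ∶ A ∷ Γ
  ⊢ˢ-ctx-conv {A = A} dA′ dA c = ⊢ˢ-wk dA′ ∷ˢ
    ⊢-cast refl (rename-as-subst (λ _ → refl) A) (conv (start dA′) (weak dA dA′) (≃-shift c))

  ⊢-ctx-conv : ∀ {Γ A A′ s s′ t T} → A ∷ Γ ⊢ t ∶ T → Γ ⊢ A′ ∶ srt s′ → Γ ⊢ A ∶ srt s → A′ ≃ A →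
               A′ ∷ Γ ⊢ t ∶ T
  ⊢-ctx-conv {t = t} {T} d dA′ dA c =
    ⊢-cast (subst-id (λ _ → refl) t) (subst-id (λ _ → refl) T) (⊢-subst d (⊢ˢ-ctx-conv dA′ dA c))

  record GenPi (Γ : Ctx) (A B T : Tm) : Set where
    constructor genPi
    field
      {s₁ s₂ s₃} : Sort
      rule       : Rl s₁ s₂ s₃
      domain     : Γ ⊢ A ∶ srt s₁
      codomain   : A ∷ Γ ⊢ B ∶ srt s₂
      sort≃      : srt s₃ ≃ T

  gen-pi : ∀ {Γ t T A B} → Γ ⊢ t ∶ T → t ≡ pi A B → GenPi Γ A B T
  gen-pi (prod r dA dB) refl = genPi r dA dB ε
  gen-pi (weak {t = pi _ _} d dC) refl with gen-pi d refl
  ... | genPi r dA dB c =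
    genPi r (weak dA dC) (⊢-rename (ext′ suc) dB (⊢ˢ-ext suc (⊢ˢ-wk dC) (weak dA dC))) (≃-shift c)
  gen-pi (conv d _ c′) e with gen-pi d e
  ... | genPi r dA dB c = genPi r dA dB (c ◅◅ c′)
  gen-pi (axiom _) ()
  gen-pi (const _ _) ()
  gen-pi (start _) ()
  gen-pi (abs _ _) ()
  gen-pi (appl _ _) ()
  gen-pi (weak {t = var _} _ _) ()
  gen-pi (weak {t = srt _} _ _) ()
  gen-pi (weak {t = cst _} _ _) ()
  gen-pi (weak {t = lam _ _} _ _) ()
  gen-pi (weak {t = app _ _} _ _) ()

  record GenLam (Γ : Ctx) (A b T : Tm) : Set where
    constructor genLam
    field
      {B}  : Tm
      {s}  : Sort
      body : A ∷ Γ ⊢ b ∶ B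
      type : Γ ⊢ pi A B ∶ srt s
      pi≃  : pi A B ≃ T

  gen-lam : ∀ {Γ t T A b} → Γ ⊢ t ∶ T → t ≡ lam A b → GenLam Γ A b T
  gen-lam (abs db dpi) refl = genLam db dpi ε
  gen-lam (weak {t = lam _ _} d dC) refl with gen-lam d refl
  ... | genLam db dpi c with pi-domain-sorted (weak dpi dC) refl
  ... | _ , dA = genLam (⊢-rename (ext′ suc) db (⊢ˢ-ext suc (⊢ˢ-wk dC) dA)) (weak dpi dC) (≃-shift c)
  gen-lam (conv d _ c′) e with gen-lam d e
  ... | genLam db dpi c = genLam db dpi (c ◅◅ c′)
  gen-lam (axiom _) ()
  gen-lam (const _ _) ()
  gen-lam (start _) ()
  gen-lam (prod _ _ _) ()
  gen-lam (appl _ _) ()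
  gen-lam (weak {t = var _} _ _) ()
  gen-lam (weak {t = srt _} _ _) ()
  gen-lam (weak {t = cst _} _ _) ()
  gen-lam (weak {t = pi _ _} _ _) ()
  gen-lam (weak {t = app _ _} _ _) ()

  record GenApp (Γ : Ctx) (f a T : Tm) : Set where
    constructor genApp
    field
      {A B}    : Tm
      function : Γ ⊢ f ∶ pi A B
      argument : Γ ⊢ a ∶ A
      result≃  : (B [ a ]) ≃ T

  gen-app : ∀ {Γ t T f a} → Γ ⊢ t ∶ T → t ≡ app f a → GenApp Γ f a T
  gen-app (appl df da) refl = genApp df da ε
  gen-app (weak {t = app _ a} d dC) refl with gen-app d refl
  ... | genApp {B = B} df da c =
    genApp (weak df dC) (weak da dC) (subst₂ _≃_ (rename-[] suc B a) refl (≃-shift c))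
  gen-app (conv d _ c′) e with gen-app d e
  ... | genApp df da c = genApp df da (c ◅◅ c′)
  gen-app (axiom _) ()
  gen-app (const _ _) ()
  gen-app (start _) ()
  gen-app (prod _ _ _) ()
  gen-app (abs _ _) ()
  gen-app (weak {t = var _} _ _) ()
  gen-app (weak {t = srt _} _ _) ()
  gen-app (weak {t = cst _} _ _) ()
  gen-app (weak {t = pi _ _} _ _) ()
  gen-app (weak {t = lam _ _} _ _) ()

  gen-srt : ∀ {Γ t T s} → Γ ⊢ t ∶ T → t ≡ srt s → ∃ λ s′ → Ax s s′ × srt s′ ≃ T
  gen-srt (axiom a) refl = _ , a , ε
  gen-srt (weak {t = srt _} d _) refl with gen-srt d refl
  ... | s′ , a , c = s′ , a , ≃-shift c
  gen-srt (conv d _ c′) e with gen-srt d e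
  ... | s′ , a , c = s′ , a , c ◅◅ c′
  gen-srt (const _ _) ()
  gen-srt (start _) ()
  gen-srt (prod _ _ _) ()
  gen-srt (abs _ _) ()
  gen-srt (appl _ _) ()
  gen-srt (weak {t = var _} _ _) ()
  gen-srt (weak {t = cst _} _ _) ()
  gen-srt (weak {t = pi _ _} _ _) ()
  gen-srt (weak {t = lam _ _} _ _) ()
  gen-srt (weak {t = app _ _} _ _) ()

  -- The clause for the empty context is junk: no variable is typable there.
  lookupTy : Ctx → ℕ → Tm
  lookupTy []      _       = var zero
  lookupTy (A ∷ Γ) zero    = shift A
  lookupTy (A ∷ Γ) (suc n) = shift (lookupTy Γ n)

  gen-var : ∀ {Γ t T n} → Γ ⊢ t ∶ T → t ≡ var n → lookupTy Γ n ≃ T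
  gen-var (start _) refl = ε
  gen-var (weak {t = var _} d _) refl = ≃-shift (gen-var d refl)
  gen-var (conv d _ c) e = gen-var d e ◅◅ c
  gen-var (axiom _) ()
  gen-var (const _ _) ()
  gen-var (prod _ _ _) ()
  gen-var (abs _ _) ()
  gen-var (appl _ _) ()
  gen-var (weak {t = srt _} _ _) ()
  gen-var (weak {t = cst _} _ _) ()
  gen-var (weak {t = pi _ _} _ _) ()
  gen-var (weak {t = lam _ _} _ _) ()
  gen-var (weak {t = app _ _} _ _) ()

  type-correct : ∀ {Γ t T} → Γ ⊢ t ∶ T → (∃ λ s → T ≡ srt s) ⊎ (∃ λ s → Γ ⊢ T ∶ srt s)
  type-correct (axiom _)     = inj₁ (_ , refl)
  type-correct (const _ d)   = inj₂ (_ , d)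
  type-correct (start d)     = inj₂ (_ , weak d d)
  type-correct (weak d dA) with type-correct d
  ... | inj₁ (s , refl) = inj₁ (s , refl)
  ... | inj₂ (s , dT)   = inj₂ (s , weak dT dA)
  type-correct (prod _ _ _)  = inj₁ (_ , refl)
  type-correct (abs _ dpi)   = inj₂ (_ , dpi)
  type-correct (appl df da) with type-correct df
  ... | inj₁ (_ , ())
  ... | inj₂ (_ , dpi) = inj₂ (_ , ⊢-[] (GenPi.codomain (gen-pi dpi refl)) da)
  type-correct (conv _ dB _) = inj₂ (_ , dB)

  app-type-sorted : ∀ {Γ f A B a} → Γ ⊢ f ∶ pi A B → Γ ⊢ a ∶ A → ∃ λ s → Γ ⊢ B [ a ] ∶ srt s
  app-type-sorted df da with type-correct df
  ... | inj₁ (_ , ())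
  ... | inj₂ (_ , dpi) = _ , ⊢-[] (GenPi.codomain (gen-pi dpi refl)) da

  ≃-[] : ∀ {B B′} a → B ≃ B′ → (B [ a ]) ≃ (B′ [ a ])
  ≃-[] {B} {B′} a c = subst₂ _≃_ (sym ([]-as-single B a)) (sym ([]-as-single B′ a)) (≃-subst (single a) c)

module PTSMetatheory {S : Set} (A : S → S → Set) (R : S → S → S → Set) where
  open Typing (PTS S A R) public
  open Metatheory (PTS S A R) (λ _ ()) (λ ()) public

  ⟶β⇒≃˘ : ∀ {t u : Tm} → t ⟶β u → u ≃ t
  ⟶β⇒≃˘ s = bwd s ◅ ε

  subject-reduction : ∀ {Γ t T t′} → Γ ⊢ t ∶ T → t ⟶β t′ → Γ ⊢ t′ ∶ T
  subject-reduction (weak {t = t} d dC) s with ⟶β-rename⁻¹ suc t s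
  ... | _ , s′ , refl = weak (subject-reduction d s′) dC
  subject-reduction (prod r dA dB) (piL s) =
    prod r dA′ (⊢-ctx-conv dB dA′ dA (⟶β⇒≃˘ s))
    where dA′ = subject-reduction dA s
  subject-reduction (prod r dA dB) (piR s) = prod r dA (subject-reduction dB s)
  subject-reduction (abs db dpi) (lamL s) =
    conv (abs (⊢-ctx-conv db dA′ dA (⟶β⇒≃˘ s)) dpi′) dpi (⟶β⇒≃˘ (piL s))
    where dpi′ = subject-reduction dpi (piL s)
          dA   = proj₂ (pi-domain-sorted dpi refl)
          dA′  = proj₂ (pi-domain-sorted dpi′ refl)
  subject-reduction (abs db dpi) (lamR s) = abs (subject-reduction db s) dpi
  subject-reduction (appl df da) (appL s) = appl (subject-reduction df s) da
  subject-reduction (appl {B = B} df da) (appR s) =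
    conv (appl df (subject-reduction da s)) (proj₂ (app-type-sorted df da)) (a—↠b⇒b↔a ([]-↠β B s))
  subject-reduction (appl {a = a} df da) beta with gen-lam df refl
  ... | genLam db dpi c with pi-injective c
  ... | cA , cB =
    conv (⊢-[] db (conv da (GenPi.domain (gen-pi dpi refl)) (≃-sym cA)))
         (proj₂ (app-type-sorted df da)) (≃-[] a cB)
  subject-reduction (conv d dB c) s = conv (subject-reduction d s) dB c
  subject-reduction (axiom _) (rw ())
  subject-reduction (start _) (rw ())
  subject-reduction (prod _ _ _) (rw ())
  subject-reduction (abs _ _) (rw ())
  subject-reduction (appl _ _) (rw ())
  subject-reduction (const {c = ()} _ _) _

  subject-reduction* : ∀ {Γ t T t′} → Γ ⊢ t ∶ T → t ↠β t′ → Γ ⊢ t′ ∶ T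
  subject-reduction* d ε       = d
  subject-reduction* d (s ◅ r) = subject-reduction* (subject-reduction d s) r

  module Uniqueness (fun : Functional A R) where

    types-unique : ∀ t {Γ T₁ T₂} → Γ ⊢ t ∶ T₁ → Γ ⊢ t ∶ T₂ → T₁ ≃ T₂
    types-unique (var n) d₁ d₂ = ≃-sym (gen-var d₁ refl) ◅◅ gen-var d₂ refl
    types-unique (srt s) d₁ d₂ with gen-srt d₁ refl | gen-srt d₂ refl
    ... | _ , a₁ , c₁ | _ , a₂ , c₂ with proj₁ fun a₁ a₂
    ... | refl = ≃-sym c₁ ◅◅ c₂
    types-unique (pi D B) d₁ d₂ with gen-pi d₁ refl | gen-pi d₂ refl
    ... | genPi r₁ dA₁ dB₁ c₁ | genPi r₂ dA₂ dB₂ c₂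
      with srt-injective (types-unique D dA₁ dA₂) | srt-injective (types-unique B dB₁ dB₂)
    ... | refl | refl with proj₂ fun r₁ r₂
    ... | refl = ≃-sym c₁ ◅◅ c₂
    types-unique (lam D b) d₁ d₂ with gen-lam d₁ refl | gen-lam d₂ refl
    ... | genLam db₁ _ c₁ | genLam db₂ _ c₂ =
      ≃-sym c₁ ◅◅ Equivalence.gmap (pi D) piR (types-unique b db₁ db₂) ◅◅ c₂
    types-unique (app f a) d₁ d₂ with gen-app d₁ refl | gen-app d₂ refl
    ... | genApp df₁ _ c₁ | genApp df₂ _ c₂ =
      ≃-sym c₁ ◅◅ ≃-[] a (proj₂ (pi-injective (types-unique f df₁ df₂))) ◅◅ c₂

    sorts-unique : ∀ {Γ T s s′} → Γ ⊢ T ∶ srt s → Γ ⊢ T ∶ srt s′ → s ≡ s′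
    sorts-unique {T = T} d₁ d₂ = srt-injective (types-unique T d₁ d₂)

module λΠ-Signature {S : Set} (A : S → S → Set) (R : S → S → S → Set) where
  open Typing (λΠ A R) public renaming (_⊢_∶_ to _⊢λΠ_∶_; _≃_ to _≃λΠ_)

  ΣRw-subst : ∀ (σ : ℕ → LTm A R) {t u} → ΣRw A R t u → ΣRw A R (subst σ t) (subst σ u)
  ΣRw-subst σ (axRw a) = axRw a
  ΣRw-subst σ (rlRw {s₁} {s₂} {s₃} {X} {Y} r) =
    subst₂ (ΣRw A R) refl
      (cong (λ z → pi _ (app (cst (ε s₂)) (app z (var zero)))) (sym (subst-exts-shift σ Y)))
      (rlRw r)

  ΣTy-closed : ∀ c (σ : ℕ → LTm A R) → subst σ (ΣTy A R c) ≡ ΣTy A R c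
  ΣTy-closed (U _)        _ = refl
  ΣTy-closed (ε _)        _ = refl
  ΣTy-closed (dot _ _)    _ = refl
  ΣTy-closed (dotΠ _ _ _) _ = refl

  open Metatheory (λΠ A R) ΣRw-subst ΣTy-closed public

  Univ : S → LTm A R
  Univ s = cst (U s)

  El : S → LTm A R → LTm A R
  El s v = app (cst (ε s)) v

  Πcode : S → S → S → LTm A R → LTm A R → LTm A R
  Πcode s₁ s₂ s₃ a b = app (app (cst (dotΠ s₁ s₂ s₃)) a) (lam (El s₁ a) b)

  ⊢Univ-closed : ∀ s → [] ⊢λΠ Univ s ∶ srt Type
  ⊢Univ-closed s = const tt (axiom type:kind)

  ⊢Univ : ∀ {Γ} s → WfCtx Γ → Γ ⊢λΠ Univ s ∶ srt Type
  ⊢Univ s w = ⊢-const w tt (axiom type:kind)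

  ⊢ε-type : ∀ s → [] ⊢λΠ ΣTy A R (ε s) ∶ srt Kind
  ⊢ε-type s = prod tkk (⊢Univ-closed s) (weak (axiom type:kind) (⊢Univ-closed s))

  ⊢El : ∀ {Γ v s} → Γ ⊢λΠ v ∶ Univ s → Γ ⊢λΠ El s v ∶ srt Type
  ⊢El {s = s} dv = appl (⊢-const (⊢-wfCtx dv) tt (⊢ε-type s)) dv

  ⊢dotΠ-type : ∀ s₁ s₂ s₃ → [] ⊢λΠ ΣTy A R (dotΠ s₁ s₂ s₃) ∶ srt Type
  ⊢dotΠ-type s₁ s₂ s₃ = prod ttt (⊢Univ-closed s₁) (prod ttt ⊢dom (⊢Univ s₃ (Type , ⊢dom)))
    where ⊢El₀ = ⊢El (start (⊢Univ-closed s₁))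
          ⊢dom = prod ttt ⊢El₀ (⊢Univ s₂ (Type , ⊢El₀))

  ⊢Πcode : ∀ {Γ s₁ s₂ s₃ a b} → R s₁ s₂ s₃ → Γ ⊢λΠ a ∶ Univ s₁ → El s₁ a ∷ Γ ⊢λΠ b ∶ Univ s₂ →
           Γ ⊢λΠ Πcode s₁ s₂ s₃ a b ∶ Univ s₃
  ⊢Πcode {s₁ = s₁} {s₂} {s₃} r da db =
    appl (appl (⊢-const (⊢-wfCtx da) r (⊢dotΠ-type s₁ s₂ s₃)) da)
         (abs db (prod ttt (⊢El da) (⊢Univ s₂ (Type , ⊢El da))))

  El-Πcode : ∀ {s₁ s₂ s₃ a b} → R s₁ s₂ s₃ → El s₃ (Πcode s₁ s₂ s₃ a b) ≃λΠ pi (El s₁ a) (El s₂ b)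
  El-Πcode {b = b} r =
    fwd (rw (rlRw r)) ◅ fwd (piR (appR (subst₂ (Step (ΣRw A R)) refl (rename-ext-suc-[var-zero] b) beta))) ◅ ε

module Translation {S : Set} (A : S → S → Set) (R : S → S → S → Set) (fun : Functional A R) where
  open PTSMetatheory A R
  open Uniqueness fun
  module λΠ = λΠ-Signature A R
  open λΠ using (_⊢λΠ_∶_; _≃λΠ_; Univ; El; Πcode)

  -- `ext` at the two term types is the same function on ℕ but not
  -- definitionally so, hence renamings come in pointwise equal pairs.
  private
    ext₀ : (ℕ → ℕ) → ℕ → ℕ
    ext₀ = ext {S} {⊥}
    extλ : (ℕ → ℕ) → ℕ → ℕ
    extλ = ext {LSort} {ΣC A R}

  infix 4 _⊢_⇝_
  data _⊢_⇝_ : Ctx → Tm → LTm A R → Set where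
    ⇝var : ∀ {Γ n} → Γ ⊢ var n ⇝ var n
    ⇝srt : ∀ {Γ s s′} → A s s′ → Γ ⊢ srt s ⇝ cst (dot s s′)
    ⇝pi  : ∀ {Γ D B a b s₁ s₂ s₃} → R s₁ s₂ s₃ → Γ ⊢ D ∶ srt s₁ → D ∷ Γ ⊢ B ∶ srt s₂ →
           Γ ⊢ D ⇝ a → D ∷ Γ ⊢ B ⇝ b → Γ ⊢ pi D B ⇝ Πcode s₁ s₂ s₃ a b
    ⇝lam : ∀ {Γ D b a y s} → Γ ⊢ D ∶ srt s → Γ ⊢ D ⇝ a → D ∷ Γ ⊢ b ⇝ y →
           Γ ⊢ lam D b ⇝ lam (El s a) y
    ⇝app : ∀ {Γ t v u w} → Γ ⊢ t ⇝ u → Γ ⊢ v ⇝ w → Γ ⊢ app t v ⇝ app u w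

  ext-pointwise : ∀ {ρ ρ′ : ℕ → ℕ} → (∀ n → ρ n ≡ ρ′ n) → ∀ n → ext₀ ρ n ≡ extλ ρ′ n
  ext-pointwise h zero    = refl
  ext-pointwise h (suc n) = cong suc (h n)

  ⇝-rename : ∀ {Γ Δ t u} (ρ ρ′ : ℕ → ℕ) → (∀ n → ρ n ≡ ρ′ n) → Γ ⊢ t ⇝ u → Δ ⊢ˢ var ∘ ρ ∶ Γ →
             Δ ⊢ rename ρ t ⇝ rename ρ′ u
  ⇝-rename ρ ρ′ h (⇝var {n = n}) _ = transport (λ m → _ ⊢ var (ρ n) ⇝ var m) (h n) ⇝var
  ⇝-rename ρ ρ′ h (⇝srt a) _ = ⇝srt a
  ⇝-rename ρ ρ′ h (⇝pi r dD dB tD tB) hρ =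
    ⇝pi r dD′ (⊢-rename (ext₀ ρ) dB hρ′) (⇝-rename ρ ρ′ h tD hρ)
      (⇝-rename (ext₀ ρ) (extλ ρ′) (ext-pointwise h) tB hρ′)
    where dD′ = ⊢-rename ρ dD hρ
          hρ′ = ⊢ˢ-ext ρ hρ dD′
  ⇝-rename ρ ρ′ h (⇝lam dD tD tb) hρ =
    ⇝lam dD′ (⇝-rename ρ ρ′ h tD hρ) (⇝-rename (ext₀ ρ) (extλ ρ′) (ext-pointwise h) tb (⊢ˢ-ext ρ hρ dD′))
    where dD′ = ⊢-rename ρ dD hρ
  ⇝-rename ρ ρ′ h (⇝app t₁ t₂) hρ = ⇝app (⇝-rename ρ ρ′ h t₁ hρ) (⇝-rename ρ ρ′ h t₂ hρ)

  ⇝-weaken : ∀ {Γ t u D s} → Γ ⊢ t ⇝ u → Γ ⊢ D ∶ srt s → D ∷ Γ ⊢ shift t ⇝ shift u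
  ⇝-weaken tr dD = ⇝-rename suc suc (λ _ → refl) tr (⊢ˢ-wk dD)

  ⇝-exts : ∀ {Δ D s} {σ : ℕ → Tm} {τ : ℕ → LTm A R} → (∀ n → Δ ⊢ σ n ⇝ τ n) → Δ ⊢ D ∶ srt s →
           ∀ n → D ∷ Δ ⊢ exts σ n ⇝ exts τ n
  ⇝-exts h dD zero    = ⇝var
  ⇝-exts h dD (suc n) = ⇝-weaken (h n) dD

  ⇝-subst : ∀ {Γ Δ t u} (σ : ℕ → Tm) (τ : ℕ → LTm A R) → Γ ⊢ t ⇝ u → Δ ⊢ˢ σ ∶ Γ →
            (∀ n → Δ ⊢ σ n ⇝ τ n) → Δ ⊢ subst σ t ⇝ subst τ u
  ⇝-subst σ τ (⇝var {n = n}) _ h = h n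
  ⇝-subst σ τ (⇝srt a) _ _ = ⇝srt a
  ⇝-subst σ τ (⇝pi r dD dB tD tB) hσ h =
    ⇝pi r dD′ (⊢-subst dB (⊢ˢ-exts hσ dD′)) (⇝-subst σ τ tD hσ h)
      (⇝-subst (exts σ) (exts τ) tB (⊢ˢ-exts hσ dD′) (⇝-exts h dD′))
    where dD′ = ⊢-subst dD hσ
  ⇝-subst σ τ (⇝lam dD tD tb) hσ h =
    ⇝lam dD′ (⇝-subst σ τ tD hσ h) (⇝-subst (exts σ) (exts τ) tb (⊢ˢ-exts hσ dD′) (⇝-exts h dD′))
    where dD′ = ⊢-subst dD hσ
  ⇝-subst σ τ (⇝app t₁ t₂) hσ h = ⇝app (⇝-subst σ τ t₁ hσ h) (⇝-subst σ τ t₂ hσ h)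

  ⇝-[] : ∀ {Γ D b y a z} → D ∷ Γ ⊢ b ⇝ y → Γ ⊢ a ∶ D → Γ ⊢ a ⇝ z → Γ ⊢ b [ a ] ⇝ subst (single z) y
  ⇝-[] {b = b} {a = a} tb da ta =
    transport (λ x → _ ⊢ x ⇝ _) (sym ([]-as-single b a))
      (⇝-subst (single a) _ tb (⊢ˢ-single da) λ { zero → ta ; (suc n) → ⇝var })

  ⇝-ctx-conv : ∀ {Γ D D′ s s′ t u} → D ∷ Γ ⊢ t ⇝ u → Γ ⊢ D′ ∶ srt s′ → Γ ⊢ D ∶ srt s → D′ ≃ D →
               D′ ∷ Γ ⊢ t ⇝ u
  ⇝-ctx-conv {t = t} {u} tr dD′ dD c =
    subst₂ (_ ⊢_⇝_) (subst-id (λ _ → refl) t) (subst-id (λ _ → refl) u)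
      (⇝-subst var var tr (⊢ˢ-ctx-conv dD′ dD c) λ _ → ⇝var)

  ⇝-unique : ∀ {Γ t u u′} → Γ ⊢ t ⇝ u → Γ ⊢ t ⇝ u′ → u ≡ u′
  ⇝-unique ⇝var ⇝var = refl
  ⇝-unique (⇝srt a) (⇝srt a′) with proj₁ fun a a′
  ... | refl = refl
  ⇝-unique (⇝pi r dD dB tD tB) (⇝pi r′ dD′ dB′ tD′ tB′)
    with sorts-unique dD dD′ | sorts-unique dB dB′
  ... | refl | refl with proj₂ fun r r′ | ⇝-unique tD tD′ | ⇝-unique tB tB′
  ... | refl | refl | refl = refl
  ⇝-unique (⇝lam dD tD tb) (⇝lam dD′ tD′ tb′) with sorts-unique dD dD′ | ⇝-unique tD tD′ | ⇝-unique tb tb′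
  ... | refl | refl | refl = refl
  ⇝-unique (⇝app t₁ t₂) (⇝app t₁′ t₂′) with ⇝-unique t₁ t₁′ | ⇝-unique t₂ t₂′
  ... | refl | refl = refl

  infix 4 _⟶λΠ_ _↠λΠ_ _↠⁺λΠ_

  _⟶λΠ_ : LTm A R → LTm A R → Set
  _⟶λΠ_ = Step (ΣRw A R)

  _↠λΠ_ : LTm A R → LTm A R → Set
  _↠λΠ_ = Star _⟶λΠ_

  _↠⁺λΠ_ : LTm A R → LTm A R → Set
  u ↠⁺λΠ u′ = ∃ λ m → u ⟶λΠ m × m ↠λΠ u′

  ↠⁺-map : (f : LTm A R → LTm A R) → (∀ {x y} → x ⟶λΠ y → f x ⟶λΠ f y) →
           ∀ {x y} → x ↠⁺λΠ y → f x ↠⁺λΠ f y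
  ↠⁺-map f g (m , s , r) = f m , g s , gmap f g r

  ↠⁺⇒↠ : ∀ {x y} → x ↠⁺λΠ y → x ↠λΠ y
  ↠⁺⇒↠ (_ , s , r) = s ◅ r

  _↠⁺◅◅_ : ∀ {x y z} → x ↠⁺λΠ y → y ↠λΠ z → x ↠⁺λΠ z
  (m , s , r) ↠⁺◅◅ r′ = m , s , r ◅◅ r′

  ⇝-simulation : ∀ {Γ t u T t′} → Γ ⊢ t ⇝ u → Γ ⊢ t ∶ T → t ⟶β t′ → ∃ λ u′ → u ↠⁺λΠ u′ × Γ ⊢ t′ ⇝ u′
  ⇝-simulation (⇝app (⇝lam {y = y} dD _ tb) ta) d (beta {u = a}) with gen-app d refl
  ... | genApp df da _ with gen-lam df refl
  ... | genLam _ _ c =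
    _ , (_ , subst₂ _⟶λΠ_ refl ([]-as-single y _) beta , ε) ,
    ⇝-[] tb (conv da dD (≃-sym (proj₁ (pi-injective c)))) ta
  -- ‖D‖ occurs twice in ‖Πx:D. B‖: the first copy makes the required step,
  -- the second one catches up.
  ⇝-simulation (⇝pi {b = b} {s₁ = s₁} r dD dB tD tB) _ (piL s) with ⇝-simulation tD dD s
  ... | a′ , p , tD′ =
    _ , ↠⁺-map (λ x → app (app _ x) (lam (El s₁ _) b)) (appL ∘ appR) p
          ↠⁺◅◅ gmap (λ x → app (app _ a′) (lam (El s₁ x) b)) (appR ∘ lamL ∘ appR) (↠⁺⇒↠ p) ,
    ⇝pi r dD′ (⊢-ctx-conv dB dD′ dD (⟶β⇒≃˘ s)) tD′ (⇝-ctx-conv tB dD′ dD (⟶β⇒≃˘ s))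
    where dD′ = subject-reduction dD s
  ⇝-simulation (⇝pi {a = a} {s₁ = s₁} r dD dB tD tB) _ (piR s) with ⇝-simulation tB dB s
  ... | _ , p , tB′ =
    _ , ↠⁺-map (λ x → app (app _ a) (lam (El s₁ a) x)) (appR ∘ lamR) p ,
    ⇝pi r dD (subject-reduction dB s) tD tB′
  ⇝-simulation (⇝lam {y = y} {s = s₀} dD tD tb) _ (lamL s) with ⇝-simulation tD dD s
  ... | _ , p , tD′ =
    _ , ↠⁺-map (λ x → lam (El s₀ x) y) (lamL ∘ appR) p ,
    ⇝lam dD′ tD′ (⇝-ctx-conv tb dD′ dD (⟶β⇒≃˘ s))
    where dD′ = subject-reduction dD s
  ⇝-simulation (⇝lam {a = a} {s = s₀} dD tD tb) d (lamR s) with ⇝-simulation tb (GenLam.body (gen-lam d refl)) s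
  ... | _ , p , tb′ = _ , ↠⁺-map (lam (El s₀ a)) lamR p , ⇝lam dD tD tb′
  ⇝-simulation (⇝app {w = w} t₁ t₂) d (appL s) with ⇝-simulation t₁ (GenApp.function (gen-app d refl)) s
  ... | _ , p , t₁′ = _ , ↠⁺-map (λ x → app x w) appL p , ⇝app t₁′ t₂
  ⇝-simulation (⇝app {u = u} t₁ t₂) d (appR s) with ⇝-simulation t₂ (GenApp.argument (gen-app d refl)) s
  ... | _ , p , t₂′ = _ , ↠⁺-map (app u) appR p , ⇝app t₁ t₂′
  ⇝-simulation _ _ (rw ())

  ⇝-↠ : ∀ {Γ t u T t′} → Γ ⊢ t ⇝ u → Γ ⊢ t ∶ T → t ↠β t′ → ∃ λ u′ → u ↠λΠ u′ × Γ ⊢ t′ ⇝ u′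
  ⇝-↠ tr d ε = _ , ε , tr
  ⇝-↠ tr d (s ◅ r) with ⇝-simulation tr d s
  ... | _ , p , tr₁ with ⇝-↠ tr₁ (subject-reduction d s) r
  ... | u₂ , r₂ , tr₂ = u₂ , ↠⁺⇒↠ p ◅◅ r₂ , tr₂

  -- λΠ_P typings cannot be inverted here (that would need confluence of
  -- λΠ_P), so the typings of the components of a translated Π-type are
  -- carried along with it.
  data PiTyped : λΠ.Ctx → Tm → LTm A R → Set where
    pt-pi  : ∀ {Δ D B a b s₁ s₂ s₃} → Δ ⊢λΠ a ∶ Univ s₁ → El s₁ a ∷ Δ ⊢λΠ b ∶ Univ s₂ →
             PiTyped Δ D a → PiTyped (El s₁ a ∷ Δ) B b → PiTyped Δ (pi D B) (Πcode s₁ s₂ s₃ a b)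
    pt-var : ∀ {Δ n} → PiTyped Δ (var n) (var n)
    pt-srt : ∀ {Δ s u} → PiTyped Δ (srt s) u
    pt-lam : ∀ {Δ D b u} → PiTyped Δ (lam D b) u
    pt-app : ∀ {Δ t v u} → PiTyped Δ (app t v) u

  PiTyped-rename : ∀ {Δ Δ′ t u} (ρ ρ′ : ℕ → ℕ) → (∀ n → ρ n ≡ ρ′ n) → PiTyped Δ t u →
                   Δ′ λΠ.⊢ˢ var ∘ ρ′ ∶ Δ → PiTyped Δ′ (rename ρ t) (rename ρ′ u)
  PiTyped-rename ρ ρ′ h (pt-pi da db pa pb) hρ =
    pt-pi da′ (λΠ.⊢-rename (extλ ρ′) db hρ′) (PiTyped-rename ρ ρ′ h pa hρ)
      (PiTyped-rename (ext₀ ρ) (extλ ρ′) (ext-pointwise h) pb hρ′)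
    where da′ = λΠ.⊢-rename ρ′ da hρ
          hρ′ = λΠ.⊢ˢ-ext ρ′ hρ (λΠ.⊢El da′)
  PiTyped-rename ρ ρ′ h (pt-var {n = n}) _ = transport (λ m → PiTyped _ (var (ρ n)) (var m)) (h n) pt-var
  PiTyped-rename ρ ρ′ h pt-srt _ = pt-srt
  PiTyped-rename ρ ρ′ h pt-lam _ = pt-lam
  PiTyped-rename ρ ρ′ h pt-app _ = pt-app

  PiTyped-weaken : ∀ {Δ t u D s} → PiTyped Δ t u → Δ ⊢λΠ D ∶ srt s → PiTyped (D ∷ Δ) (shift t) (shift u)
  PiTyped-weaken p dD = PiTyped-rename suc suc (λ _ → refl) p (λΠ.⊢ˢ-wk dD)

  PiTyped-subst : ∀ {Δ Δ′ t u} (σ : ℕ → Tm) (τ : ℕ → LTm A R) → PiTyped Δ t u → Δ′ λΠ.⊢ˢ τ ∶ Δ →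
                  (∀ n → PiTyped Δ′ (σ n) (τ n)) → PiTyped Δ′ (subst σ t) (subst τ u)
  PiTyped-subst σ τ (pt-pi da db pa pb) hτ h =
    pt-pi da′ (λΠ.⊢-subst db hτ′) (PiTyped-subst σ τ pa hτ h) (PiTyped-subst (exts σ) (exts τ) pb hτ′ h′)
    where da′ = λΠ.⊢-subst da hτ
          hτ′ = λΠ.⊢ˢ-exts hτ (λΠ.⊢El da′)
          h′ : ∀ n → PiTyped _ (exts σ n) (exts τ n)
          h′ zero    = pt-var
          h′ (suc n) = PiTyped-weaken (h n) (λΠ.⊢El da′)
  PiTyped-subst σ τ pt-var _ h = h _
  PiTyped-subst σ τ pt-srt _ _ = pt-srt
  PiTyped-subst σ τ pt-lam _ _ = pt-lam
  PiTyped-subst σ τ pt-app _ _ = pt-app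

  PiTyped-[] : ∀ {Δ X B b t u} → PiTyped (X ∷ Δ) B b → Δ ⊢λΠ u ∶ X → PiTyped Δ t u →
               PiTyped Δ (B [ t ]) (subst (single u) b)
  PiTyped-[] {B = B} {t = t} p du pu =
    transport (λ x → PiTyped _ x _) (sym ([]-as-single B t))
      (PiTyped-subst (single t) (single _) p (λΠ.⊢ˢ-single du) λ { zero → pu ; (suc n) → pt-var })

  infix 4 _∣_⊢_⇝ᵀ_ _⇝ᶜ_

  data _∣_⊢_⇝ᵀ_ (Γ : Ctx) (Δ : λΠ.Ctx) : Tm → LTm A R → Set where
    ⇝ᵀsrt : ∀ {s} → Γ ∣ Δ ⊢ srt s ⇝ᵀ Univ s
    ⇝ᵀEl  : ∀ {T s v} → Γ ⊢ T ∶ srt s → Γ ⊢ T ⇝ v → Δ ⊢λΠ v ∶ Univ s → PiTyped Δ T v →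
            Γ ∣ Δ ⊢ T ⇝ᵀ El s v

  data _⇝ᶜ_ : Ctx → λΠ.Ctx → Set where
    []ᶜ  : [] ⇝ᶜ []
    _∷ᶜ_ : ∀ {Γ Δ D X} → Γ ⇝ᶜ Δ → Γ ∣ Δ ⊢ D ⇝ᵀ X → D ∷ Γ ⇝ᶜ X ∷ Δ

  ⇝ᵀ-typed : ∀ {Γ Δ T X} → λΠ.WfCtx Δ → Γ ∣ Δ ⊢ T ⇝ᵀ X → Δ ⊢λΠ X ∶ srt Type
  ⇝ᵀ-typed w ⇝ᵀsrt              = λΠ.⊢Univ _ w
  ⇝ᵀ-typed _ (⇝ᵀEl _ _ dv _)    = λΠ.⊢El dv

  ⇝ᶜ-wf : ∀ {Γ Δ} → Γ ⇝ᶜ Δ → λΠ.WfCtx Δ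
  ⇝ᶜ-wf []ᶜ        = tt
  ⇝ᶜ-wf (h ∷ᶜ tD) = Type , ⇝ᵀ-typed (⇝ᶜ-wf h) tD

  ⇝ᵀ-weaken : ∀ {Γ Δ T X D s E s′} → Γ ∣ Δ ⊢ T ⇝ᵀ X → Γ ⊢ D ∶ srt s → Δ ⊢λΠ E ∶ srt s′ →
              D ∷ Γ ∣ E ∷ Δ ⊢ shift T ⇝ᵀ shift X
  ⇝ᵀ-weaken ⇝ᵀsrt _ _ = ⇝ᵀsrt
  ⇝ᵀ-weaken (⇝ᵀEl dT tT dv p) dD dE = ⇝ᵀEl (weak dT dD) (⇝-weaken tT dD) (λΠ.weak dv dE) (PiTyped-weaken p dE)

  ⇝ᵀ-srt : ∀ {Γ Δ s X u} → Γ ∣ Δ ⊢ srt s ⇝ᵀ X → Δ ⊢λΠ u ∶ X → Δ ⊢λΠ u ∶ Univ s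
  ⇝ᵀ-srt ⇝ᵀsrt du = du
  ⇝ᵀ-srt (⇝ᵀEl dT (⇝srt a) _ _) du with gen-srt dT refl
  ... | _ , a′ , c with srt-injective c | proj₁ fun a a′
  ... | refl | refl = λΠ.conv du (λΠ.⊢Univ _ (λΠ.⊢-wfCtx du)) (fwd (rw (axRw a)) ◅ ε)

  El-≃-Univ : ∀ {Γ s B s′ v} → srt s ≃ B → Γ ⊢ B ∶ srt s′ → Γ ⊢ B ⇝ v → El s′ v ≃λΠ Univ s
  El-≃-Univ c dB tB with =β⇒joinable c
  ... | _ , r₁ , r₂ with ↠β-srt r₁
  ... | refl with ⇝-↠ tB dB r₂
  ... | _ , r , ⇝srt a with gen-srt (subject-reduction* dB r₂) refl
  ... | _ , a′ , c′ with srt-injective c′ | proj₁ fun a a′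
  ... | refl | refl = a—↠b⇒a↔b (gmap (El _) appR r) ◅◅ fwd (rw (axRw a)) ◅ ε

  ⇝ᵀ-≃ : ∀ {Γ Δ T T′ X X′} → Γ ∣ Δ ⊢ T ⇝ᵀ X → Γ ∣ Δ ⊢ T′ ⇝ᵀ X′ → T ≃ T′ → X ≃λΠ X′
  ⇝ᵀ-≃ ⇝ᵀsrt ⇝ᵀsrt c with srt-injective c
  ... | refl = ε
  ⇝ᵀ-≃ ⇝ᵀsrt (⇝ᵀEl dT′ tT′ _ _) c = λΠ.≃-sym (El-≃-Univ c dT′ tT′)
  ⇝ᵀ-≃ (⇝ᵀEl dT tT _ _) ⇝ᵀsrt c = El-≃-Univ (≃-sym c) dT tT
  ⇝ᵀ-≃ (⇝ᵀEl dT tT _ _) (⇝ᵀEl dT′ tT′ _ _) c with =β⇒joinable c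
  ... | _ , r , r′ with sorts-unique (subject-reduction* dT r) (subject-reduction* dT′ r′)
                      | ⇝-↠ tT dT r | ⇝-↠ tT′ dT′ r′
  ... | refl | _ , l , tW | _ , l′ , tW′ with ⇝-unique tW tW′
  ... | refl = a—↠b⇒a↔b (gmap (El _) appR l) ◅◅ a—↠b⇒b↔a (gmap (El _) appR l′)

  pi-sort : ∀ {Γ D B s s₁ s₂ s₃} → Γ ⊢ pi D B ∶ srt s → R s₁ s₂ s₃ → Γ ⊢ D ∶ srt s₁ →
            D ∷ Γ ⊢ B ∶ srt s₂ → s₃ ≡ s
  pi-sort dpi r dD dB with gen-pi dpi refl
  ... | genPi r′ dD′ dB′ c with sorts-unique dD dD′ | sorts-unique dB dB′
  ... | refl | refl with proj₂ fun r r′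
  ... | refl = srt-injective c

  record Sound (Γ : Ctx) (Δ : λΠ.Ctx) (t T : Tm) : Set where
    constructor sound
    field
      {u X}       : LTm A R
      translation : Γ ⊢ t ⇝ u
      type-tr     : Γ ∣ Δ ⊢ T ⇝ᵀ X
      typed       : Δ ⊢λΠ u ∶ X
      pi-typed    : PiTyped Δ t u

  translation-sound : ∀ {Γ Δ t T} → Γ ⊢ t ∶ T → Γ ⇝ᶜ Δ → Sound Γ Δ t T
  translation-sound (axiom a) []ᶜ = sound (⇝srt a) ⇝ᵀsrt (λΠ.const a (λΠ.⊢Univ-closed _)) pt-srt
  translation-sound (start dD) (h ∷ᶜ tD) =
    sound ⇝var (⇝ᵀ-weaken tD dD dX) (λΠ.start dX) pt-var
    where dX = ⇝ᵀ-typed (⇝ᶜ-wf h) tD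
  translation-sound (weak d dD) (h ∷ᶜ tD) with translation-sound d h
  ... | sound tr tT du p = sound (⇝-weaken tr dD) (⇝ᵀ-weaken tT dD dX) (λΠ.weak du dX) (PiTyped-weaken p dX)
    where dX = ⇝ᵀ-typed (⇝ᶜ-wf h) tD
  translation-sound (prod r dD dB) h with translation-sound dD h
  ... | sound tD tTD da pD with translation-sound dB (h ∷ᶜ ⇝ᵀEl dD tD (⇝ᵀ-srt tTD da) pD)
  ... | sound tB tTB db pB =
    sound (⇝pi r dD dB tD tB) ⇝ᵀsrt (λΠ.⊢Πcode r da′ db′) (pt-pi da′ db′ pD pB)
    where da′ = ⇝ᵀ-srt tTD da
          db′ = ⇝ᵀ-srt tTB db
  translation-sound (abs db dpi) h with translation-sound dpi h
  ... | sound (⇝pi r dD dB tD tB) tP dP (pt-pi da dbB pD pB) with pi-sort dpi r dD dB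
  ... | refl with translation-sound db (h ∷ᶜ ⇝ᵀEl dD tD da pD)
  ... | sound tb tTB dy _ =
    sound (⇝lam dD tD tb) (⇝ᵀEl dpi (⇝pi r dD dB tD tB) dP′ (pt-pi da dbB pD pB))
      (λΠ.conv (λΠ.abs dy (λΠ.prod ttt (λΠ.⊢El da) (⇝ᵀ-typed (Type , λΠ.⊢El da) tTB)))
               (λΠ.⊢El dP′)
               (λΠ.≃-sym (λΠ.El-Πcode r ◅◅ Equivalence.gmap (pi _) piR (⇝ᵀ-≃ (⇝ᵀEl dB tB dbB pB) tTB ε))))
      pt-lam
    where dP′ = ⇝ᵀ-srt tP dP
  translation-sound (appl df da) h with translation-sound df h
  ... | sound tf (⇝ᵀEl dpi (⇝pi {b = b} {s₂ = s₂} r dD dB tD tB) _ (pt-pi dva dvb pD pB)) duf _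
    with pi-sort dpi r dD dB | translation-sound da h
  ... | refl | sound {u = ua} ta tTA dua pa =
    sound (⇝app tf ta)
      (⇝ᵀEl (⊢-[] dB da) (⇝-[] tB da ta) (λΠ.⊢-subst dvb hs)
        (PiTyped-[] pB dua′ pa))
      (λΠ.⊢-cast refl ([]-as-single (El s₂ b) ua) (λΠ.appl duf′ dua′))
      pt-app
    where dua′ = λΠ.conv dua (λΠ.⊢El dva) (⇝ᵀ-≃ tTA (⇝ᵀEl dD tD dva pD) ε)
          duf′ = λΠ.conv duf (λΠ.prod ttt (λΠ.⊢El dva) (λΠ.⊢El dvb)) (λΠ.El-Πcode r)
          hs   = λΠ.⊢ˢ-single dua′
  translation-sound (conv d dB c) h with translation-sound d h | translation-sound dB h
  ... | sound ta tTA dua pa | sound tB tS duB pB =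
    sound ta tTB (λΠ.conv dua (λΠ.⊢El duB′) (⇝ᵀ-≃ tTA tTB c)) pa
    where duB′ = ⇝ᵀ-srt tS duB
          tTB  = ⇝ᵀEl dB tB duB′ pB
  translation-sound (const {c = ()} _ _) _

  ctx-translation-exists : ∀ Γ → WfCtx Γ → ∃ λ Δ → Γ ⇝ᶜ Δ
  ctx-translation-exists []      _        = [] , []ᶜ
  ctx-translation-exists (D ∷ Γ) (_ , dD) with ctx-translation-exists Γ (⊢-wfCtx dD)
  ... | _ , h with translation-sound dD h
  ... | sound tD tT dd pD = _ , h ∷ᶜ ⇝ᵀEl dD tD (⇝ᵀ-srt tT dd) pD

  TypedTranslation : Tm → LTm A R → Set
  TypedTranslation t u = ∃ λ Γ → ∃ λ T → Γ ⊢ t ∶ T × Γ ⊢ t ⇝ u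

  typed-simulation : ∀ {t t′ u} → TypedTranslation t u → t ⟶β t′ →
                     ∃ λ u′ → u ↠⁺λΠ u′ × TypedTranslation t′ u′
  typed-simulation (_ , _ , d , tr) s with ⇝-simulation tr d s
  ... | u′ , p , tr′ = u′ , p , (_ , _ , subject-reduction d s , tr′)

proposition4 : {S : Set} (A : S → S → Set) (R : S → S → S → Set) →
               Functional A R →
               Typing.Terminates (λΠ A R) →
               Typing.Terminates (PTS S A R)
proposition4 A R fun sn d =
  Acc-simulated TypedTranslation typed-simulation (_ , _ , d , translation) (sn typed)
  where
  open PTSMetatheory A R using (⊢-wfCtx)
  open Translation A R fun
  open Sound (translation-sound d (proj₂ (ctx-translation-exists _ (⊢-wfCtx d))))
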